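{- Let $m \ge 3$ be an odd integer and let $\Gamma = C_m \square C_{2m}$. If $\Gamma$ admits a distance magic labeling and $L$ is the $m \times 2m$ table corresponding to a distance magic labeling of $\Gamma$, then the reduced table $re(L)$ is distance magic. Conversely, if an $m \times m$ table $T$ is distance magic, then the extended table $ex(T)$ corresponds to a distance magic labeling of $\Gamma$, and consequently $\Gamma$ is distance magic.
   Context: For a positive integer $N$ let $\mathcal{N}_N=\{1-N,3-N,\ldots,N-1\}$. A distance magic labeling of a graph $\Gamma=(V,E)$ of order $N$ is a bijection $\ell: V \to \mathcal{N}_N$ such that for every vertex the sum of the labels of its neighbours is $0$. $C_m \square C_{n}$ is the Cayley graph of $\mathbb{Z}_m\times\mathbb{Z}_n$ with connection set $\{\pm(1,0),\pm(0,1)\}$; a labeling $\ell$ is represented by the $m\times n$ table $L=[\ell_{i,j}]$ with $\ell_{i,j}=\ell((i,j))$; in all $m \times n$ tables the first index is taken modulo $m$ and the second modulo $n$. For $m$ odd and an $m\times 2m$ table $L=[\ell_{i,j}]$, the reduced table $re(L)$ is the $m\times m$ table $[t_{i,j}]$ with $t_{i,j}=\ell_{i,2j}$. For an $m\times m$ table $T=[t_{i,j}]$, the extended table $ex(T)$ is the $m\times 2m$ table $[\ell_{i,j}]$ with $\ell_{i,j}=t_{i,j/2}$ if $j$ is even and $\ell_{i,j}=-t_{i,(j+m)/2}$ if $j$ is odd ($0\le j<2m$). An $m\times m$ table $T=[t_{i,j}]$ ($m$ odd) is distance magic if (i) for every $k\in\mathcal{N}_{2m^2}$ exactly one of $k,-k$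 appears in $T$, and (ii) $t_{i-1,j}+t_{i+1,j}=t_{i,j+\frac{m-1}{2}}+t_{i,j-\frac{m-1}{2}}$ for all $0\le i,j<m$. -}

module Defs where

open import Data.Nat as ℕ using (ℕ; zero; suc)
open import Data.Integer as ℤ using (ℤ; +_; _-_; -_; _%ℕ_)
open import Data.Integer.DivMod using (n%ℕd<d)
open import Data.Fin using (Fin; toℕ; fromℕ<)
open import Data.Product using (Σ; ∃; ∃-syntax; _×_; _,_)
open import Data.Sum using (_⊎_)
open import Relation.Nullary using (¬_)
open import Relation.Binary.PropositionalEquality using (_≡_)

Odd : ℕ → Set
Odd m = ∃[ k ] m ≡ 2 ℕ.* k ℕ.+ 1

In𝒩 : ℕ → ℤ → Set
In𝒩 N k = ∃[ j ] (j ℕ.< N × k ≡ (+ 1 - + N) ℤ.+ + (2 ℕ.* j))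

-- an m × n table of integer labels; entry (i,j) is the label of vertex (i,j)
Tbl : ℕ → ℕ → Set
Tbl m n = Fin m → Fin n → ℤ

wrap : (n : ℕ) → ℤ → Fin (suc n)
wrap n i = fromℕ< (n%ℕd<d i (suc n))

-- entry access with first index mod m and second index mod n
-- (the value for an empty table is irrelevant)
get : ∀ {m n} → Tbl m n → ℤ → ℤ → ℤ
get {zero} L i j = + 0
get {suc m} {zero} L i j = + 0
get {suc m} {suc n} L i j = L (wrap m i) (wrap n j)

ι : ∀ {n} → Fin n → ℤ
ι i = + toℕ i

IsDMLabeling : ∀ {m n} → Tbl m n → Set
IsDMLabeling {m} {n} L =
  (∀ i j → In𝒩 (m ℕ.* n) (L i j))
  × (∀ i j i′ j′ → L i j ≡ L i′ j′ → (i ≡ i′ × j ≡ j′))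
  × (∀ k → In𝒩 (m ℕ.* n) k → ∃[ i ] ∃[ j ] L i j ≡ k)
  × (∀ (i : Fin m) (j : Fin n) → get L (ι i - + 1) (ι j) ℤ.+ get L (ι i ℤ.+ + 1) (ι j)
               ℤ.+ get L (ι i) (ι j - + 1) ℤ.+ get L (ι i) (ι j ℤ.+ + 1) ≡ + 0)

IsDistanceMagic : ℕ → ℕ → Set
IsDistanceMagic m n = Σ (Tbl m n) IsDMLabeling

Appears : ∀ {m n} → Tbl m n → ℤ → Set
Appears T k = ∃[ i ] ∃[ j ] T i j ≡ k

IsDMTable : ∀ {m} → Tbl m m → Set
IsDMTable {m} T =
  (∀ k → In𝒩 (2 ℕ.* (m ℕ.* m)) k →
     (Appears T k ⊎ Appears T (- k)) × ¬ (Appears T k × Appears T (- k)))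
  × (∀ (i : Fin m) (j : Fin m) → get T (ι i - + 1) (ι j) ℤ.+ get T (ι i ℤ.+ + 1) (ι j)
               ≡ get T (ι i) (ι j ℤ.+ + h) ℤ.+ get T (ι i) (ι j - + h))
  where h = (m ℕ.∸ 1) ℕ./ 2

re : ∀ {m} → Tbl m (2 ℕ.* m) → Tbl m m
re L i j = get L (ι i) (+ (2 ℕ.* toℕ j))

ex : ∀ {m} → Tbl m m → Tbl m (2 ℕ.* m)
ex {m} T i j = aux (toℕ j ℕ.% 2)
  where
  aux : ℕ → ℤ
  aux zero = get T (ι i) (+ (toℕ j ℕ./ 2))
  aux (suc _) = - get T (ι i) (+ ((toℕ j ℕ.+ m) ℕ./ 2))

-- Write m = 2h + 1 and read every table as a function on ℤ², periodic in both indices.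
--
-- A function u with period m in both indices and zero neighbour sums vanishes: the zero sum at
-- (i + 1, j) says that the diagonal pairs u(i, j) + u(i + 1, j + 1) change sign along
-- antidiagonals, so they vanish because m is odd; then u itself changes sign along diagonals and
-- vanishes for the same reason. If F comes from a distance magic labelling of C_m □ C_2m, applying
-- this to F(i, j) + F(i, j + m) gives F(i, j + m) = -F(i, j). Hence F is determined by its even
-- columns t(i, c) = F(i, 2c) through F(i, 2c + 1) = -t(i, c + h + 1), and its neighbour sums are,
-- up to sign, t(i - 1, c) + t(i + 1, c) - t(i, c + h) - t(i, c - h). So zero neighbour sums of F
-- amount to the relation (ii) for t; here t = re L, while ex T is exactly the F built from t = T.
--
-- If k and -k were both entries of re L, antiperiodicity would put the label k into L twice, in
-- columns of different parity. Bijectivity of ex T is counting: by (i) the m² cells of T cover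
-- all m² pairs ±(2s + 1), s < m², so each cell carries exactly one of them.

module Submission where

import Data.Integer.Properties as ℤP
open import Algebra.Properties.AbelianGroup ℤP.+-0-abelianGroup using (inverseʳ-unique)
open import Data.Empty using (⊥-elim)
open import Data.Fin using (Fin; toℕ; combine; punchOut)
import Data.Fin.Properties as FinP
open import Data.Integer using (ℤ; +_; -[1+_]; +[1+_]; -_; _+_; _-_; ∣_∣; _/ℕ_; _%ℕ_)
open import Data.Integer.DivMod using (a≡a%ℕn+[a/ℕn]*n)
open import Data.Integer.Tactic.RingSolver using (solve)
open import Data.List using (_∷_; [])
open import Data.Nat as ℕ using (ℕ; zero; suc)
import Data.Nat.Properties as ℕP
open import Data.Product using (∃-syntax; _×_; _,_; proj₁; proj₂)
open import Data.Sum using (_⊎_; inj₁; inj₂)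
open import Function using (_∘_)
open import Relation.Binary.PropositionalEquality
open import Relation.Nullary using (¬_; yes; no)
open ≡-Reasoning

open import Defs

neighbourSum : (ℤ → ℤ → ℤ) → ℤ → ℤ → ℤ
neighbourSum u i j = u (i - + 1) j + u (i + + 1) j + u i (j - + 1) + u i (j + + 1)

ZeroNeighbourSums : (ℤ → ℤ → ℤ) → Set
ZeroNeighbourSums u = ∀ i j → neighbourSum u i j ≡ + 0

zeroNeighbourSums-+ : ∀ f g → ZeroNeighbourSums f → ZeroNeighbourSums g →
                      ZeroNeighbourSums (λ i j → f i j + g i j)
zeroNeighbourSums-+ f g f-sums g-sums i j = begin
  (a + a′) + (b + b′) + (c + c′) + (d + d′) ≡⟨ interchange a a′ b b′ c c′ d d′ ⟩
  (a + b + c + d) + (a′ + b′ + c′ + d′)     ≡⟨ cong₂ _+_ (f-sums i j) (g-sums i j) ⟩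
  + 0                                       ∎
  where
  a a′ b b′ c c′ d d′ : ℤ
  a  = f (i - + 1) j
  a′ = g (i - + 1) j
  b  = f (i + + 1) j
  b′ = g (i + + 1) j
  c  = f i (j - + 1)
  c′ = g i (j - + 1)
  d  = f i (j + + 1)
  d′ = g i (j + + 1)

  interchange : ∀ a a′ b b′ c c′ d d′ →
                (a + a′) + (b + b′) + (c + c′) + (d + d′) ≡ (a + b + c + d) + (a′ + b′ + c′ + d′)
  interchange a a′ b b′ c c′ d d′ = solve (a ∷ a′ ∷ b ∷ b′ ∷ c ∷ c′ ∷ d ∷ d′ ∷ [])

zeroNeighbourSums-shift : ∀ f → ZeroNeighbourSums f → ∀ s → ZeroNeighbourSums (λ i j → f i (j + s))
zeroNeighbourSums-shift f f-sums s i j = begin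
  f (i - + 1) (j + s) + f (i + + 1) (j + s) + f i (j - + 1 + s) + f i (j + + 1 + s)
    ≡⟨ cong₂ (λ x y → f (i - + 1) (j + s) + f (i + + 1) (j + s) + f i x + f i y)
             (solve (j ∷ s ∷ [])) (solve (j ∷ s ∷ [])) ⟩
  neighbourSum f i (j + s)
    ≡⟨ f-sums i (j + s) ⟩
  + 0 ∎

i≡-i⇒i≡0 : ∀ {i} → i ≡ - i → i ≡ + 0
i≡-i⇒i≡0 {+ zero}    _  = refl
i≡-i⇒i≡0 {+[1+ n ]}  ()
i≡-i⇒i≡0 { -[1+ n ]} ()

even-or-odd : ∀ n → ∃[ q ] (n ≡ 2 ℕ.* q ⊎ n ≡ suc (2 ℕ.* q))
even-or-odd zero    = 0 , inj₁ refl
even-or-odd (suc n) with even-or-odd n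
... | q , inj₁ refl = q , inj₂ refl
... | q , inj₂ refl = suc q , inj₁ (cong suc (sym (ℕP.+-suc q (q ℕ.+ 0))))

fin-even-or-odd : ∀ {n} (b : Fin (2 ℕ.* n)) →
                  ∃[ q ] q ℕ.< n × (toℕ b ≡ 2 ℕ.* q ⊎ toℕ b ≡ suc (2 ℕ.* q))
fin-even-or-odd {n} b with even-or-odd (toℕ b)
... | q , parity = q , ℕP.*-cancelˡ-< 2 q n (ℕP.≤-<-trans (2q≤b parity) (FinP.toℕ<n b)) , parity
  where
  2q≤b : toℕ b ≡ 2 ℕ.* q ⊎ toℕ b ≡ suc (2 ℕ.* q) → 2 ℕ.* q ℕ.≤ toℕ b
  2q≤b (inj₁ b≡) = ℕP.≤-reflexive (sym b≡)
  2q≤b (inj₂ b≡) = ℕP.≤-trans (ℕP.n≤1+n _) (ℕP.≤-reflexive (sym b≡))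

injective⇒surjective : ∀ {N} {f : Fin N → Fin N} → (∀ {x y} → f x ≡ f y → x ≡ y) →
                       ∀ y → ∃[ x ] f x ≡ y
injective⇒surjective {suc N} {f} f-injective y with FinP.any? (λ x → f x FinP.≟ y)
... | yes hit  = hit
... | no  miss = ⊥-elim (ℕP.1+n≰n (FinP.injective⇒≤ squeezed-injective))
  where
  f≢y : ∀ x → y ≢ f x
  f≢y x y≡fx = miss (x , sym y≡fx)

  squeezed : Fin (suc N) → Fin N
  squeezed x = punchOut (f≢y x)

  squeezed-injective : ∀ {x x′} → squeezed x ≡ squeezed x′ → x ≡ x′
  squeezed-injective eq = f-injective (FinP.punchOut-injective (f≢y _) (f≢y _) eq)

module Congruence where
  open import Data.Integer using (_*_)

  infix 4 _≡_mod_
  record _≡_mod_ (x y d : ℤ) : Set where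
    constructor ⟨_,_⟩
    field
      quotient : ℤ
      equation : x ≡ y + quotient * d

  ≡-mod-reflexive : ∀ {x y d} → x ≡ y → x ≡ y mod d
  ≡-mod-reflexive {x} refl = ⟨ + 0 , sym (ℤP.+-identityʳ x) ⟩

  ≡-mod-refl : ∀ {x d} → x ≡ x mod d
  ≡-mod-refl = ≡-mod-reflexive refl

  ≡-mod-sym : ∀ {x y d} → x ≡ y mod d → y ≡ x mod d
  ≡-mod-sym {x} {y} {d} ⟨ k , x≡ ⟩ = ⟨ - k , (begin
    y               ≡⟨ solve (y ∷ k ∷ d ∷ []) ⟩
    y + k * d + - k * d ≡⟨ cong (_+ - k * d) x≡ ⟨
    x + - k * d     ∎) ⟩

  ≡-mod-trans : ∀ {x y z d} → x ≡ y mod d → y ≡ z mod d → x ≡ z mod d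
  ≡-mod-trans {x} {y} {z} {d} ⟨ k , x≡ ⟩ ⟨ l , y≡ ⟩ = ⟨ l + k , (begin
    x                 ≡⟨ x≡ ⟩
    y + k * d         ≡⟨ cong (_+ k * d) y≡ ⟩
    z + l * d + k * d ≡⟨ solve (z ∷ l ∷ k ∷ d ∷ []) ⟩
    z + (l + k) * d   ∎) ⟩

  ≡-mod-+ʳ : ∀ {x y d} c → x ≡ y mod d → x + c ≡ y + c mod d
  ≡-mod-+ʳ {x} {y} {d} c ⟨ k , x≡ ⟩ = ⟨ k , (begin
    x + c         ≡⟨ cong (_+ c) x≡ ⟩
    y + k * d + c ≡⟨ solve (y ∷ k ∷ d ∷ c ∷ []) ⟩
    y + c + k * d ∎) ⟩

  ≡-mod-+ʳ-cancel : ∀ {x y d} c → x + c ≡ y + c mod d → x ≡ y mod d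
  ≡-mod-+ʳ-cancel {x} {y} {d} c ⟨ k , x+c≡ ⟩ = ⟨ k , (begin
    x                 ≡⟨ solve (x ∷ c ∷ []) ⟩
    x + c - c         ≡⟨ cong (_- c) x+c≡ ⟩
    y + c + k * d - c ≡⟨ solve (y ∷ c ∷ k ∷ d ∷ []) ⟩
    y + k * d         ∎) ⟩

  ≡-mod-double : ∀ {x y d} → x ≡ y mod d → + 2 * x ≡ + 2 * y mod + 2 * d
  ≡-mod-double {x} {y} {d} ⟨ k , x≡ ⟩ = ⟨ k , (begin
    + 2 * x           ≡⟨ cong (+ 2 *_) x≡ ⟩
    + 2 * (y + k * d) ≡⟨ solve (y ∷ k ∷ d ∷ []) ⟩
    + 2 * y + k * (+ 2 * d) ∎) ⟩

  ≡-mod-halve : ∀ {x y d} → + 2 * x ≡ + 2 * y mod + 2 * d → x ≡ y mod d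
  ≡-mod-halve {x} {y} {d} ⟨ k , 2x≡ ⟩ = ⟨ k , ℤP.*-cancelˡ-≡ (+ 2) x (y + k * d) (begin
    + 2 * x                 ≡⟨ 2x≡ ⟩
    + 2 * y + k * (+ 2 * d) ≡⟨ solve (y ∷ k ∷ d ∷ []) ⟩
    + 2 * (y + k * d)       ∎) ⟩

  even≢odd-mod : ∀ {x y d} → ¬ (+ 2 * x ≡ + 2 * y + + 1 mod + 2 * d)
  even≢odd-mod {x} {y} {d} ⟨ k , 2x≡ ⟩ = twice≢1 (x - y - k * d) (begin
    + 2 * (x - y - k * d)               ≡⟨ solve (x ∷ y ∷ k ∷ d ∷ []) ⟩
    + 2 * x - (+ 2 * y + k * (+ 2 * d)) ≡⟨ cong (λ z → z - (+ 2 * y + k * (+ 2 * d))) 2x≡ ⟩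
    + 2 * y + + 1 + k * (+ 2 * d) - (+ 2 * y + k * (+ 2 * d)) ≡⟨ solve (y ∷ k ∷ d ∷ []) ⟩
    + 1                                 ∎)
    where
    twice≢1 : ∀ z → + 2 * z ≢ + 1
    twice≢1 (+ zero)  ()
    twice≢1 +[1+ n ]  eq = ℕP.even≢odd (suc n) 0 (ℤP.+-injective (trans (ℤP.pos-* 2 (suc n)) eq))
    twice≢1 -[1+ n ]  ()

  private
    multiple≥modulus : ∀ {r s n} k → + r ≡ + s + +[1+ k ] * + n → n ℕ.≤ r
    multiple≥modulus {r} {s} {n} k eq =
      ℕP.≤-trans (ℕP.m≤m+n n (k ℕ.* n)) (ℕP.≤-trans (ℕP.m≤n+m _ s) (ℕP.≤-reflexive (sym r≡)))
      where
      r≡ : r ≡ s ℕ.+ suc k ℕ.* n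
      r≡ = ℤP.+-injective (trans eq (cong (_+_ (+ s)) (sym (ℤP.pos-* (suc k) n))))

  ≡-mod⇒≡ : ∀ {r s n} → r ℕ.< n → s ℕ.< n → + r ≡ + s mod + n → r ≡ s
  ≡-mod⇒≡ _   _   ⟨ + zero   , eq ⟩ = ℤP.+-injective (trans eq (ℤP.+-identityʳ _))
  ≡-mod⇒≡ r<n _   ⟨ +[1+ k ] , eq ⟩ = ⊥-elim (ℕP.<⇒≱ r<n (multiple≥modulus k eq))
  ≡-mod⇒≡ {n = n} _ s<n ⟨ -[1+ k ] , eq ⟩ =
    ⊥-elim (ℕP.<⇒≱ s<n (multiple≥modulus k (_≡_mod_.equation (≡-mod-sym {d = + n} ⟨ -[1+ k ] , eq ⟩))))

  ι-≡-mod⇒≡ : ∀ {n} {a b : Fin n} → ι a ≡ ι b mod + n → a ≡ b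
  ι-≡-mod⇒≡ {a = a} {b} eq = FinP.toℕ-injective (≡-mod⇒≡ (FinP.toℕ<n a) (FinP.toℕ<n b) eq)

  ι-wrap : ∀ n x → ι (wrap n x) ≡ x mod + suc n
  ι-wrap n x = ≡-mod-sym ⟨ x /ℕ suc n , (begin
    x                                       ≡⟨ a≡a%ℕn+[a/ℕn]*n x (suc n) ⟩
    + (x %ℕ suc n) + (x /ℕ suc n) * + suc n
      ≡⟨ cong (λ r → + r + (x /ℕ suc n) * + suc n) (FinP.toℕ-fromℕ< _) ⟨
    ι (wrap n x) + (x /ℕ suc n) * + suc n   ∎) ⟩

  wrap-cong : ∀ n {x y} → x ≡ y mod + suc n → wrap n x ≡ wrap n y
  wrap-cong n {x} {y} x≡y =
    ι-≡-mod⇒≡ (≡-mod-trans (ι-wrap n x) (≡-mod-trans x≡y (≡-mod-sym (ι-wrap n y))))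

  wrap-ι : ∀ n (a : Fin (suc n)) → wrap n (ι a) ≡ a
  wrap-ι n a = ι-≡-mod⇒≡ (ι-wrap n (ι a))

  wrap-injective : ∀ n {x y} → wrap n x ≡ wrap n y → x ≡ y mod + suc n
  wrap-injective n {x} {y} eq =
    ≡-mod-trans (≡-mod-sym (ι-wrap n x)) (subst (λ a → ι a ≡ y mod + suc n) (sym eq) (ι-wrap n y))

  ι-even : ∀ {n} (b : Fin n) q → toℕ b ≡ 2 ℕ.* q → ι b ≡ + 2 * + q
  ι-even _ q b≡ = trans (cong +_ b≡) (ℤP.pos-* 2 q)

  ι-odd : ∀ {n} (b : Fin n) q → toℕ b ≡ suc (2 ℕ.* q) → ι b ≡ + 2 * + q + + 1
  ι-odd _ q b≡ = trans (cong +_ b≡) (begin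
    + suc (2 ℕ.* q)   ≡⟨ cong (_+_ (+ 1)) (ℤP.pos-* 2 q) ⟩
    + 1 + + 2 * + q   ≡⟨ ℤP.+-comm (+ 1) (+ 2 * + q) ⟩
    + 2 * + q + + 1   ∎)

  module _ {a b} (L : Tbl (suc a) (suc b)) where

    get-cong : ∀ {x x′ y y′} → x ≡ x′ mod + suc a → y ≡ y′ mod + suc b → get L x y ≡ get L x′ y′
    get-cong x≡ y≡ = cong₂ L (wrap-cong a x≡) (wrap-cong b y≡)

    get-ι : ∀ i j → get L (ι i) (ι j) ≡ L i j
    get-ι i j = cong₂ L (wrap-ι a i) (wrap-ι b j)

    appears-value : ∀ x y {v} → get L x y ≡ v → Appears L v
    appears-value x y eq = wrap a x , wrap b y , eq

    neighbourSum-cong : ∀ {x x′ y y′} → x ≡ x′ mod + suc a → y ≡ y′ mod + suc b →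
                        neighbourSum (get L) x y ≡ neighbourSum (get L) x′ y′
    neighbourSum-cong x≡ y≡ = cong₂ _+_ (cong₂ _+_ (cong₂ _+_
      (get-cong (≡-mod-+ʳ (- + 1) x≡) y≡)
      (get-cong (≡-mod-+ʳ (+ 1) x≡) y≡))
      (get-cong x≡ (≡-mod-+ʳ (- + 1) y≡)))
      (get-cong x≡ (≡-mod-+ʳ (+ 1) y≡))

    get-injective : (∀ i j i′ j′ → L i j ≡ L i′ j′ → i ≡ i′ × j ≡ j′) →
                    ∀ {x y x′ y′} → get L x y ≡ get L x′ y′ → x ≡ x′ mod + suc a × y ≡ y′ mod + suc b
    get-injective L-injective eq with L-injective _ _ _ _ eq
    ... | i≡ , j≡ = wrap-injective a i≡ , wrap-injective b j≡

  module _ {p} (f : ℤ → ℤ) (periodic : ∀ x → f (x + p) ≡ f x) where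

    private
      step : ∀ k x → f (x + (+ 1 + k) * p) ≡ f (x + k * p)
      step k x = begin
        f (x + (+ 1 + k) * p) ≡⟨ cong f (solve (x ∷ k ∷ p ∷ [])) ⟩
        f (x + k * p + p)     ≡⟨ periodic (x + k * p) ⟩
        f (x + k * p)         ∎

      shift-ℕ : ∀ n x → f (x + + n * p) ≡ f x
      shift-ℕ zero    x = cong f (ℤP.+-identityʳ x)
      shift-ℕ (suc n) x = trans (step (+ n) x) (shift-ℕ n x)

      unshift : ∀ k x → (∀ y → f (y + k * p) ≡ f y) → f (x + - k * p) ≡ f x
      unshift k x shift = begin
        f (x + - k * p)         ≡⟨ shift (x + - k * p) ⟨
        f (x + - k * p + k * p) ≡⟨ cong f (solve (x ∷ k ∷ p ∷ [])) ⟩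
        f x                     ∎

    periodic-respects-mod : ∀ {x y} → x ≡ y mod p → f x ≡ f y
    periodic-respects-mod {y = y} ⟨ + n      , x≡ ⟩ = trans (cong f x≡) (shift-ℕ n y)
    periodic-respects-mod {y = y} ⟨ -[1+ n ] , x≡ ⟩ =
      trans (cong f x≡) (unshift (+ suc n) y (shift-ℕ (suc n)))

module OddPeriod (H : ℤ) where
  open import Data.Integer using (_*_)
  open Congruence

  -- K is the inverse of 2 modulo M; both are inlined so that the ring solver sees H.
  M K : ℤ
  M = + 1 + + 2 * H
  K = + 1 + H
  {-# INLINE M #-}
  {-# INLINE K #-}

  alternating⇒≡0 : (f : ℤ → ℤ) → (∀ x → f (x + + 1) ≡ - f x) → (∀ x → f (x + M) ≡ f x) →
                   ∀ x → f x ≡ + 0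
  alternating⇒≡0 f alternates periodic x = i≡-i⇒i≡0 (begin
    f x                   ≡⟨ periodic x ⟨
    f (x + M)             ≡⟨ cong f (solve (x ∷ H ∷ [])) ⟩
    f (x + H * + 2 + + 1) ≡⟨ alternates (x + H * + 2) ⟩
    - f (x + H * + 2)     ≡⟨ cong -_ (periodic-respects-mod f 2-periodic ⟨ H , refl ⟩) ⟩
    - f x                 ∎)
    where
    2-periodic : ∀ x → f (x + + 2) ≡ f x
    2-periodic x = begin
      f (x + + 2)       ≡⟨ cong f (solve (x ∷ [])) ⟩
      f (x + + 1 + + 1) ≡⟨ alternates (x + + 1) ⟩
      - f (x + + 1)     ≡⟨ cong -_ (alternates x) ⟩
      - - f x           ≡⟨ ℤP.neg-involutive (f x) ⟩
      f x               ∎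

  even≢even+M : ∀ {x y d} → ¬ (+ 2 * x ≡ + 2 * y + M mod + 2 * d)
  even≢even+M {x} {y} {d} = even≢odd-mod {x} {y + H} {d} ∘ subst (λ z → + 2 * x ≡ z mod + 2 * d) odd-form
    where
    odd-form : + 2 * y + M ≡ + 2 * (y + H) + + 1
    odd-form = solve (y ∷ H ∷ [])

  module _ (u : ℤ → ℤ → ℤ) (zero-sums : ZeroNeighbourSums u)
           (periodic₁ : ∀ i j → u (i + M) j ≡ u i j) (periodic₂ : ∀ i j → u i (j + M) ≡ u i j) where

    private
      u-cong : ∀ {i i′ j j′} → i ≡ i′ mod M → j ≡ j′ mod M → u i j ≡ u i′ j′
      u-cong {i} {i′} {j} {j′} i≡ j≡ =
        trans (periodic-respects-mod (λ x → u x j) (λ x → periodic₁ x j) i≡)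
              (periodic-respects-mod (u i′) (periodic₂ i′) j≡)

      diagonalPair : ℤ → ℤ → ℤ
      diagonalPair i j = u i j + u (i + + 1) (j + + 1)

      rearrange : ∀ a b c d → a + b + c + d ≡ + 0 → c + b ≡ - (a + d)
      rearrange a b c d sum≡0 = inverseʳ-unique (a + d) (c + b) (begin
        a + d + (c + b) ≡⟨ solve (a ∷ b ∷ c ∷ d ∷ []) ⟩
        a + b + c + d   ≡⟨ sum≡0 ⟩
        + 0             ∎)

      diagonalPair-alternates : ∀ i j → diagonalPair (i + + 1) (j - + 1) ≡ - diagonalPair i j
      diagonalPair-alternates i j = begin
        diagonalPair (i + + 1) (j - + 1)
          ≡⟨ cong (λ y → c + u (i + + 1 + + 1) y) (solve (j ∷ [])) ⟩
        c + b
          ≡⟨ rearrange a b c d (begin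
               a + b + c + d              ≡⟨ cong (λ x → u x j + b + c + d) (solve (i ∷ [])) ⟩
               neighbourSum u (i + + 1) j ≡⟨ zero-sums (i + + 1) j ⟩
               + 0                        ∎) ⟩
        - diagonalPair i j ∎
        where
        a b c d : ℤ
        a = u i j
        b = u (i + + 1 + + 1) j
        c = u (i + + 1) (j - + 1)
        d = u (i + + 1) (j + + 1)

      diagonalPair≡0 : ∀ i j → diagonalPair i j ≡ + 0
      diagonalPair≡0 i j = begin
        diagonalPair i j                 ≡⟨ cong₂ diagonalPair (ℤP.+-identityʳ i) (ℤP.+-identityʳ j) ⟨
        diagonalPair (i + + 0) (j - + 0) ≡⟨ alternating⇒≡0 f alternates periodic (+ 0) ⟩
        + 0                              ∎
        where
        f : ℤ → ℤ
        f t = diagonalPair (i + t) (j - t)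

        alternates : ∀ t → f (t + + 1) ≡ - f t
        alternates t = begin
          diagonalPair (i + (t + + 1)) (j - (t + + 1))
            ≡⟨ cong₂ diagonalPair (solve (i ∷ t ∷ [])) (solve (j ∷ t ∷ [])) ⟩
          diagonalPair (i + t + + 1) (j - t - + 1)
            ≡⟨ diagonalPair-alternates (i + t) (j - t) ⟩
          - diagonalPair (i + t) (j - t) ∎

        periodic : ∀ t → f (t + M) ≡ f t
        periodic t =
          cong₂ _+_ (u-cong ⟨ + 1 , solve (i ∷ t ∷ H ∷ []) ⟩ ⟨ - + 1 , solve (j ∷ t ∷ H ∷ []) ⟩)
                    (u-cong ⟨ + 1 , solve (i ∷ t ∷ H ∷ []) ⟩ ⟨ - + 1 , solve (j ∷ t ∷ H ∷ []) ⟩)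

    zeroNeighbourSums⇒≡0 : ∀ i j → u i j ≡ + 0
    zeroNeighbourSums⇒≡0 i j = begin
      u i j                 ≡⟨ cong₂ u (ℤP.+-identityʳ i) (ℤP.+-identityʳ j) ⟨
      u (i + + 0) (j + + 0) ≡⟨ alternating⇒≡0 f alternates periodic (+ 0) ⟩
      + 0                   ∎
      where
      f : ℤ → ℤ
      f t = u (i + t) (j + t)

      alternates : ∀ t → f (t + + 1) ≡ - f t
      alternates t = begin
        u (i + (t + + 1)) (j + (t + + 1)) ≡⟨ cong₂ u (solve (i ∷ t ∷ [])) (solve (j ∷ t ∷ [])) ⟩
        u (i + t + + 1) (j + t + + 1)     ≡⟨ inverseʳ-unique _ _ (diagonalPair≡0 (i + t) (j + t)) ⟩
        - u (i + t) (j + t)               ∎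

      periodic : ∀ t → f (t + M) ≡ f t
      periodic t = u-cong ⟨ + 1 , solve (i ∷ t ∷ H ∷ []) ⟩ ⟨ + 1 , solve (j ∷ t ∷ H ∷ []) ⟩

  antiperiodic : ∀ {F} → ZeroNeighbourSums F →
                 (∀ i j → F (i + M) j ≡ F i j) → (∀ i j → F i (j + + 2 * M) ≡ F i j) →
                 ∀ i j → F i (j + M) ≡ - F i j
  antiperiodic {F} zero-sums periodic₁ periodic₂ i j = inverseʳ-unique (F i j) (F i (j + M))
    (zeroNeighbourSums⇒≡0 u u-zero-sums u-periodic₁ u-periodic₂ i j)
    where
    u : ℤ → ℤ → ℤ
    u i j = F i j + F i (j + M)

    u-zero-sums : ZeroNeighbourSums u
    u-zero-sums =
      zeroNeighbourSums-+ F (λ i j → F i (j + M)) zero-sums (zeroNeighbourSums-shift F zero-sums M)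

    u-periodic₁ : ∀ i j → u (i + M) j ≡ u i j
    u-periodic₁ i j = cong₂ _+_ (periodic₁ i j) (periodic₁ i (j + M))

    u-periodic₂ : ∀ i j → u i (j + M) ≡ u i j
    u-periodic₂ i j = begin
      F i (j + M) + F i (j + M + M)   ≡⟨ cong (λ y → F i (j + M) + F i y) (solve (j ∷ H ∷ [])) ⟩
      F i (j + M) + F i (j + + 2 * M) ≡⟨ cong (_+_ (F i (j + M))) (periodic₂ i j) ⟩
      F i (j + M) + F i j             ≡⟨ ℤP.+-comm (F i (j + M)) (F i j) ⟩
      F i j + F i (j + M)             ∎

  verticalSum : (ℤ → ℤ → ℤ) → ℤ → ℤ → ℤ
  verticalSum t i c = t (i - + 1) c + t (i + + 1) c

  horizontalSum : (ℤ → ℤ → ℤ) → ℤ → ℤ → ℤ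
  horizontalSum t i c = t i (c + H) + t i (c - H)

  module Interleaving (F t : ℤ → ℤ → ℤ)
    (even : ∀ i c → F i (+ 2 * c) ≡ t i c)
    (odd : ∀ i c → F i (+ 2 * c + + 1) ≡ - t i (c + K))
    (t-periodic : ∀ i c → t i (c + M) ≡ t i c) where

    neighbourSum-even : ∀ i c → neighbourSum F i (+ 2 * c) ≡ verticalSum t i c - horizontalSum t i c
    neighbourSum-even i c = begin
      F (i - + 1) (+ 2 * c) + F (i + + 1) (+ 2 * c) + F i (+ 2 * c - + 1) + F i (+ 2 * c + + 1)
        ≡⟨ cong₂ _+_ (cong₂ _+_ (cong₂ _+_ (even (i - + 1) c) (even (i + + 1) c)) left) right ⟩
      t (i - + 1) c + t (i + + 1) c + - t i (c + H) + - t i (c - H)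
        ≡⟨ collect (t (i - + 1) c) (t (i + + 1) c) (t i (c + H)) (t i (c - H)) ⟩
      verticalSum t i c - horizontalSum t i c ∎
      where
      collect : ∀ a b x y → a + b + - x + - y ≡ a + b - (x + y)
      collect a b x y = solve (a ∷ b ∷ x ∷ y ∷ [])

      left : F i (+ 2 * c - + 1) ≡ - t i (c + H)
      left = begin
        F i (+ 2 * c - + 1)         ≡⟨ cong (F i) (solve (c ∷ [])) ⟩
        F i (+ 2 * (c - + 1) + + 1) ≡⟨ odd i (c - + 1) ⟩
        - t i (c - + 1 + K)         ≡⟨ cong (λ x → - t i x) (solve (c ∷ H ∷ [])) ⟩
        - t i (c + H)               ∎

      right : F i (+ 2 * c + + 1) ≡ - t i (c - H)
      right = begin
        F i (+ 2 * c + + 1) ≡⟨ odd i c ⟩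
        - t i (c + K)       ≡⟨ cong (λ x → - t i x) (solve (c ∷ H ∷ [])) ⟩
        - t i (c - H + M)   ≡⟨ cong -_ (t-periodic i (c - H)) ⟩
        - t i (c - H)       ∎

    neighbourSum-odd : ∀ i c → neighbourSum F i (+ 2 * c + + 1) ≡
                               - (verticalSum t i (c + K) - horizontalSum t i (c + K))
    neighbourSum-odd i c = begin
      F (i - + 1) (+ 2 * c + + 1) + F (i + + 1) (+ 2 * c + + 1)
        + F i (+ 2 * c + + 1 - + 1) + F i (+ 2 * c + + 1 + + 1)
        ≡⟨ cong₂ _+_ (cong₂ _+_ (cong₂ _+_ (odd (i - + 1) c) (odd (i + + 1) c)) left) right ⟩
      - t (i - + 1) (c + K) + - t (i + + 1) (c + K) + t i (c + K + H) + t i (c + K - H)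
        ≡⟨ collect (t (i - + 1) (c + K)) (t (i + + 1) (c + K)) (t i (c + K + H)) (t i (c + K - H)) ⟩
      - (verticalSum t i (c + K) - horizontalSum t i (c + K)) ∎
      where
      collect : ∀ a b x y → - a + - b + x + y ≡ - (a + b - (x + y))
      collect a b x y = solve (a ∷ b ∷ x ∷ y ∷ [])

      left : F i (+ 2 * c + + 1 - + 1) ≡ t i (c + K + H)
      left = begin
        F i (+ 2 * c + + 1 - + 1) ≡⟨ cong (F i) (solve (c ∷ [])) ⟩
        F i (+ 2 * c)             ≡⟨ even i c ⟩
        t i c                     ≡⟨ t-periodic i c ⟨
        t i (c + M)               ≡⟨ cong (t i) (solve (c ∷ H ∷ [])) ⟩
        t i (c + K + H)           ∎

      right : F i (+ 2 * c + + 1 + + 1) ≡ t i (c + K - H)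
      right = begin
        F i (+ 2 * c + + 1 + + 1) ≡⟨ cong (F i) (solve (c ∷ [])) ⟩
        F i (+ 2 * (c + + 1))     ≡⟨ even i (c + + 1) ⟩
        t i (c + + 1)             ≡⟨ cong (t i) (solve (c ∷ H ∷ [])) ⟩
        t i (c + K - H)           ∎

    even-antiperiodic : ∀ i c → F i (+ 2 * c + M) ≡ - t i c
    even-antiperiodic i c = begin
      F i (+ 2 * c + M)           ≡⟨ cong (F i) (solve (c ∷ H ∷ [])) ⟩
      F i (+ 2 * (c + H) + + 1)   ≡⟨ odd i (c + H) ⟩
      - t i (c + H + K)           ≡⟨ cong (λ x → - t i x) (solve (c ∷ H ∷ [])) ⟩
      - t i (c + M)               ≡⟨ cong -_ (t-periodic i c) ⟩
      - t i c                     ∎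

  module _ {F t : ℤ → ℤ → ℤ} (antiperiodic-F : ∀ i j → F i (j + M) ≡ - F i j)
           (even : ∀ i c → F i (+ 2 * c) ≡ t i c) where

    antiperiodic⇒odd : ∀ i c → F i (+ 2 * c + + 1) ≡ - t i (c + K)
    antiperiodic⇒odd i c = begin
      F i (+ 2 * c + + 1)         ≡⟨ ℤP.neg-involutive _ ⟨
      - - F i (+ 2 * c + + 1)     ≡⟨ cong -_ (antiperiodic-F i (+ 2 * c + + 1)) ⟨
      - F i (+ 2 * c + + 1 + M)   ≡⟨ cong (λ x → - F i x) (solve (c ∷ H ∷ [])) ⟩
      - F i (+ 2 * (c + K))       ≡⟨ cong -_ (even i (c + K)) ⟩
      - t i (c + K)               ∎

    antiperiodic⇒t-periodic : ∀ i c → t i (c + M) ≡ t i c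
    antiperiodic⇒t-periodic i c = begin
      t i (c + M)               ≡⟨ even i (c + M) ⟨
      F i (+ 2 * (c + M))       ≡⟨ cong (F i) (solve (c ∷ H ∷ [])) ⟩
      F i (+ 2 * c + M + M)     ≡⟨ antiperiodic-F i (+ 2 * c + M) ⟩
      - F i (+ 2 * c + M)       ≡⟨ cong -_ (antiperiodic-F i (+ 2 * c)) ⟩
      - - F i (+ 2 * c)         ≡⟨ ℤP.neg-involutive _ ⟩
      F i (+ 2 * c)             ≡⟨ even i c ⟩
      t i c                     ∎

module LabelSet where
  open import Data.Integer using (_*_)

  private
    In𝒩-intro : ∀ {N k} j → j ℕ.< N → k ≡ + 1 - + N + + 2 * + j → In𝒩 N k
    In𝒩-intro {N} j j<N k≡ = j , j<N , trans k≡ (cong (_+_ (+ 1 - + N)) (sym (ℤP.pos-* 2 j)))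

  odd-In𝒩 : ∀ {N s} → s ℕ.< N → In𝒩 (2 ℕ.* N) (+ suc (2 ℕ.* s))
  odd-In𝒩 {N} {s} s<N = In𝒩-intro (N ℕ.+ s) N+s<2N (begin
    + 1 + + (2 ℕ.* s)                  ≡⟨ cong (_+_ (+ 1)) (ℤP.pos-* 2 s) ⟩
    + 1 + + 2 * + s                    ≡⟨ recentre (+ N) (+ s) ⟩
    + 1 - + 2 * + N + + 2 * (+ N + + s)
      ≡⟨ cong₂ (λ a b → + 1 - a + + 2 * b) (ℤP.pos-* 2 N) (ℤP.pos-+ N s) ⟨
    + 1 - + (2 ℕ.* N) + + 2 * + (N ℕ.+ s) ∎)
    where
    N+s<2N : N ℕ.+ s ℕ.< 2 ℕ.* N
    N+s<2N = subst (N ℕ.+ s ℕ.<_) (cong (N ℕ.+_) (sym (ℕP.+-identityʳ N))) (ℕP.+-monoʳ-< N s<N)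

    recentre : ∀ n s → + 1 + + 2 * s ≡ + 1 - + 2 * n + + 2 * (n + s)
    recentre n s = solve (n ∷ s ∷ [])

  In𝒩-neg : ∀ {N k} → In𝒩 N k → In𝒩 N (- k)
  In𝒩-neg {N} (j , j<N , refl) = In𝒩-intro j′ (subst (j′ ℕ.<_) N≡ (ℕP.m<m+n j′ ℕ.z<s)) (begin
    - (+ 1 - + N + + (2 ℕ.* j)) ≡⟨ cong (λ x → - (+ 1 - + N + x)) (ℤP.pos-* 2 j) ⟩
    - (+ 1 - + N + + 2 * + j)   ≡⟨ mirror (+ N) (+ j′) (+ j) (cong +_ (trans (sym N≡) (sym (ℕP.+-assoc j′ 1 j)))) ⟩
    + 1 - + N + + 2 * + j′      ∎)
    where
    j′ : ℕ
    j′ = N ℕ.∸ suc j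

    N≡ : j′ ℕ.+ suc j ≡ N
    N≡ = ℕP.m∸n+n≡m j<N

    mirror : ∀ n p j → n ≡ p + + 1 + j → - (+ 1 - n + + 2 * j) ≡ + 1 - n + + 2 * p
    mirror _ p j refl = solve (p ∷ j ∷ [])

  abs-odd⇒In𝒩 : ∀ {N s k} → s ℕ.< N → ∣ k ∣ ≡ suc (2 ℕ.* s) → In𝒩 (2 ℕ.* N) k
  abs-odd⇒In𝒩 {k = + _}     s<N refl = odd-In𝒩 s<N
  abs-odd⇒In𝒩 {k = -[1+ _ ]} s<N refl = In𝒩-neg (odd-In𝒩 s<N)

module PairCover {m n} (T : Tbl m n)
  (covers : ∀ k → In𝒩 (2 ℕ.* (m ℕ.* n)) k → Appears T k ⊎ Appears T (- k)) where
  open LabelSet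

  private
    record Cell (s : Fin (m ℕ.* n)) : Set where
      field
        row       : Fin m
        col       : Fin n
        abs-value : ∣ T row col ∣ ≡ suc (2 ℕ.* toℕ s)

    opaque
      pick : ∀ s → Cell s
      pick s with covers (+ suc (2 ℕ.* toℕ s)) (odd-In𝒩 (FinP.toℕ<n s))
      ... | inj₁ (a , b , Tab≡) = record { row = a ; col = b ; abs-value = cong ∣_∣ Tab≡ }
      ... | inj₂ (a , b , Tab≡) =
        record { row = a ; col = b ; abs-value = trans (cong ∣_∣ Tab≡) (ℤP.∣-i∣≡∣i∣ (+ suc (2 ℕ.* toℕ s))) }

    code : Fin (m ℕ.* n) → Fin (m ℕ.* n)
    code s = combine (Cell.row (pick s)) (Cell.col (pick s))

    odd-injective : ∀ {s s′ : Fin (m ℕ.* n)} → suc (2 ℕ.* toℕ s) ≡ suc (2 ℕ.* toℕ s′) → s ≡ s′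
    odd-injective {s} {s′} eq =
      FinP.toℕ-injective (ℕP.*-cancelˡ-≡ (toℕ s) (toℕ s′) 2 (ℕP.suc-injective eq))

    code-injective : ∀ {s s′ : Fin (m ℕ.* n)} → code s ≡ code s′ → s ≡ s′
    code-injective {s} {s′} eq with FinP.combine-injective _ _ _ _ eq
    ... | row≡ , col≡ = odd-injective (begin
      suc (2 ℕ.* toℕ s)                          ≡⟨ Cell.abs-value (pick s) ⟨
      ∣ T (Cell.row (pick s)) (Cell.col (pick s)) ∣ ≡⟨ cong₂ (λ a b → ∣ T a b ∣) row≡ col≡ ⟩
      ∣ T (Cell.row (pick s′)) (Cell.col (pick s′)) ∣ ≡⟨ Cell.abs-value (pick s′) ⟩
      suc (2 ℕ.* toℕ s′)                         ∎)

    abs-code : ∀ {s a b} → code s ≡ combine a b → ∣ T a b ∣ ≡ suc (2 ℕ.* toℕ s)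
    abs-code {s} {a} {b} eq with FinP.combine-injective (Cell.row (pick s)) (Cell.col (pick s)) a b eq
    ... | refl , refl = Cell.abs-value (pick s)

    label : ∀ (a : Fin m) (b : Fin n) → ∃[ s ] code s ≡ combine a b
    label a b = injective⇒surjective code-injective (combine a b)

  abs-injective : ∀ {a b a′ b′} → ∣ T a b ∣ ≡ ∣ T a′ b′ ∣ → a ≡ a′ × b ≡ b′
  abs-injective {a} {b} {a′} {b′} eq with label a b | label a′ b′
  ... | s , code-s≡ | s′ , code-s′≡ = FinP.combine-injective a b a′ b′ (begin
    combine a b   ≡⟨ code-s≡ ⟨
    code s        ≡⟨ cong code (odd-injective (trans (sym (abs-code code-s≡)) (trans eq (abs-code code-s′≡)))) ⟩
    code s′       ≡⟨ code-s′≡ ⟩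
    combine a′ b′ ∎)

  entry-In𝒩 : ∀ a b → In𝒩 (2 ℕ.* (m ℕ.* n)) (T a b)
  entry-In𝒩 a b with label a b
  ... | s , code-s≡ = abs-odd⇒In𝒩 (FinP.toℕ<n s) (abs-code code-s≡)

  entry-nonzero : ∀ a b → T a b ≢ + 0
  entry-nonzero a b Tab≡0 with label a b
  ... | s , code-s≡ = ℕP.0≢1+n (trans (cong ∣_∣ (sym Tab≡0)) (abs-code code-s≡))

module Torus (h : ℕ) where
  open import Data.Integer using (_*_)
  import Data.Nat.DivMod as ℕD
  import Data.Nat.Tactic.RingSolver as ℕ-Solver
  open Congruence
  open OddPeriod (+ h)
  open LabelSet

  m : ℕ
  m = suc (2 ℕ.* h)

  private
    +m≡M : + m ≡ M
    +m≡M = cong (_+_ (+ 1)) (ℤP.pos-* 2 h)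

    period-m : ∀ x → x + M ≡ x mod + m
    period-m x = ⟨ + 1 , cong (_+_ x) (trans (sym +m≡M) (sym (ℤP.*-identityˡ (+ m)))) ⟩

    period-2m : ∀ x → x + + 2 * M ≡ x mod + (2 ℕ.* m)
    period-2m x = ⟨ + 1 , cong (_+_ x) (begin
      + 2 * M           ≡⟨ cong (_*_ (+ 2)) +m≡M ⟨
      + 2 * + m         ≡⟨ ℤP.pos-* 2 m ⟨
      + (2 ℕ.* m)       ≡⟨ ℤP.*-identityˡ _ ⟨
      + 1 * + (2 ℕ.* m) ∎) ⟩

    mod-2m⇒ : ∀ {x y} → x ≡ y mod + (2 ℕ.* m) → x ≡ y mod + 2 * + m
    mod-2m⇒ {x} {y} = subst (λ d → x ≡ y mod d) (ℤP.pos-* 2 m)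

    ⇒mod-2m : ∀ {x y} → x ≡ y mod + 2 * + m → x ≡ y mod + (2 ℕ.* m)
    ⇒mod-2m {x} {y} = subst (λ d → x ≡ y mod d) (sym (ℤP.pos-* 2 m))

    m·2m≡2m² : m ℕ.* (2 ℕ.* m) ≡ 2 ℕ.* (m ℕ.* m)
    m·2m≡2m² = trans (sym (ℕP.*-assoc m 2 m)) (trans (cong (ℕ._* m) (ℕP.*-comm m 2)) (ℕP.*-assoc 2 m m))

    to-m·2m : ∀ {k} → In𝒩 (2 ℕ.* (m ℕ.* m)) k → In𝒩 (m ℕ.* (2 ℕ.* m)) k
    to-m·2m {k} = subst (λ N → In𝒩 N k) (sym m·2m≡2m²)

    from-m·2m : ∀ {k} → In𝒩 (m ℕ.* (2 ℕ.* m)) k → In𝒩 (2 ℕ.* (m ℕ.* m)) k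
    from-m·2m {k} = subst (λ N → In𝒩 N k) m·2m≡2m²

    half-pred : (m ℕ.∸ 1) ℕ./ 2 ≡ h
    half-pred = trans (cong (ℕ._/ 2) (ℕP.*-comm 2 h)) (ℕD.m*n/n≡m h 2)

  module Reduction (L : Tbl m (2 ℕ.* m)) (labelling : IsDMLabeling L) where

    private
      F t : ℤ → ℤ → ℤ
      F = get L
      t = get (re L)

      L-injective : ∀ i j i′ j′ → L i j ≡ L i′ j′ → i ≡ i′ × j ≡ j′
      L-injective = proj₁ (proj₂ labelling)

      L-surjective : ∀ k → In𝒩 (m ℕ.* (2 ℕ.* m)) k → Appears L k
      L-surjective = proj₁ (proj₂ (proj₂ labelling))

      F-zero-sums : ZeroNeighbourSums F
      F-zero-sums i j = trans (neighbourSum-cong L (≡-mod-sym (ι-wrap _ i)) (≡-mod-sym (ι-wrap _ j)))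
                              (proj₂ (proj₂ (proj₂ labelling)) (wrap _ i) (wrap _ j))

      F-antiperiodic : ∀ i j → F i (j + M) ≡ - F i j
      F-antiperiodic = antiperiodic F-zero-sums (λ i j → get-cong L (period-m i) (≡-mod-refl {j}))
                                                (λ i j → get-cong L (≡-mod-refl {i}) (period-2m j))

      even-columns : ∀ i c → F i (+ 2 * c) ≡ t i c
      even-columns i c = get-cong L (≡-mod-sym (ι-wrap _ i)) (⇒mod-2m 2c≡)
        where
        2c≡ : + 2 * c ≡ + (2 ℕ.* toℕ (wrap (2 ℕ.* h) c)) mod + 2 * + m
        2c≡ = ≡-mod-trans (≡-mod-double (≡-mod-sym (ι-wrap _ c)))
                          (≡-mod-reflexive (sym (ℤP.pos-* 2 (toℕ (wrap (2 ℕ.* h) c)))))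

      odd-columns : ∀ i c → F i (+ 2 * c + + 1) ≡ - t i (c + K)
      odd-columns = antiperiodic⇒odd F-antiperiodic even-columns

    open Interleaving F t even-columns odd-columns (antiperiodic⇒t-periodic F-antiperiodic even-columns)

    private
      table-relation : ∀ i c → verticalSum t i c ≡ horizontalSum t i c
      table-relation i c =
        ℤP.i-j≡0⇒i≡j _ _ (trans (sym (neighbourSum-even i c)) (F-zero-sums i (+ 2 * c)))

      covers : ∀ k → In𝒩 (2 ℕ.* (m ℕ.* m)) k → Appears (re L) k ⊎ Appears (re L) (- k)
      covers k k∈ with L-surjective k (to-m·2m k∈)
      ... | a , b , Lab≡k with fin-even-or-odd {m} b
      ...   | q , _ , inj₁ b≡ = inj₁ (appears-value (re L) (ι a) (+ q) (begin
              t (ι a) (+ q)       ≡⟨ even-columns (ι a) (+ q) ⟨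
              F (ι a) (+ 2 * + q) ≡⟨ cong (F (ι a)) (ι-even b q b≡) ⟨
              F (ι a) (ι b)       ≡⟨ get-ι L a b ⟩
              L a b               ≡⟨ Lab≡k ⟩
              k                   ∎))
      ...   | q , _ , inj₂ b≡ = inj₂ (appears-value (re L) (ι a) (+ q + K) (begin
              t (ι a) (+ q + K)           ≡⟨ ℤP.neg-involutive _ ⟨
              - - t (ι a) (+ q + K)       ≡⟨ cong -_ (odd-columns (ι a) (+ q)) ⟨
              - F (ι a) (+ 2 * + q + + 1) ≡⟨ cong (λ y → - F (ι a) y) (ι-odd b q b≡) ⟨
              - F (ι a) (ι b)             ≡⟨ cong -_ (get-ι L a b) ⟩
              - L a b                     ≡⟨ cong -_ Lab≡k ⟩
              - k                         ∎))

      exclusive : ∀ k → ¬ (Appears (re L) k × Appears (re L) (- k))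
      exclusive k ((a , b , k≡) , (a′ , b′ , -k≡)) = even≢even+M {ι b} {ι b′} {+ m} (mod-2m⇒ columns≡)
        where
        same-label : F (ι a) (+ 2 * ι b) ≡ F (ι a′) (+ 2 * ι b′ + M)
        same-label = begin
          F (ι a) (+ 2 * ι b)       ≡⟨ even-columns (ι a) (ι b) ⟩
          t (ι a) (ι b)             ≡⟨ get-ι (re L) a b ⟩
          re L a b                  ≡⟨ k≡ ⟩
          k                         ≡⟨ ℤP.neg-involutive k ⟨
          - - k                     ≡⟨ cong -_ -k≡ ⟨
          - re L a′ b′              ≡⟨ cong -_ (get-ι (re L) a′ b′) ⟨
          - t (ι a′) (ι b′)         ≡⟨ even-antiperiodic (ι a′) (ι b′) ⟨
          F (ι a′) (+ 2 * ι b′ + M) ∎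

        columns≡ : + 2 * ι b ≡ + 2 * ι b′ + M mod + (2 ℕ.* m)
        columns≡ = proj₂ (get-injective L L-injective {ι a} {+ 2 * ι b} {ι a′} {+ 2 * ι b′ + M} same-label)

    reduced-table-is-DM : IsDMTable (re L)
    reduced-table-is-DM = (λ k k∈ → covers k k∈ , exclusive k) , λ a b →
      subst (λ h′ → verticalSum t (ι a) (ι b) ≡ OddPeriod.horizontalSum (+ h′) t (ι a) (ι b))
            (sym half-pred) (table-relation (ι a) (ι b))

  module Extension (T : Tbl m m) (dm-table : IsDMTable T) where

    private
      E : Tbl m (2 ℕ.* m)
      E = ex T

      G t : ℤ → ℤ → ℤ
      G = get E
      t = get T

      covers : ∀ k → In𝒩 (2 ℕ.* (m ℕ.* m)) k → Appears T k ⊎ Appears T (- k)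
      covers k k∈ = proj₁ (proj₁ dm-table k k∈)

    open PairCover T covers

    private
      t-abs-injective : ∀ {x y x′ y′} → ∣ t x y ∣ ≡ ∣ t x′ y′ ∣ → x ≡ x′ mod + m × y ≡ y′ mod + m
      t-abs-injective {x} {y} {x′} {y′} eq =
        let row≡ , col≡ = abs-injective {wrap _ x} {wrap _ y} {wrap _ x′} {wrap _ y′} eq
        in wrap-injective _ row≡ , wrap-injective _ col≡

      t-no-opposites : ∀ x y x′ y′ → t x y ≢ - t x′ y′
      t-no-opposites x y x′ y′ eq = entry-nonzero (wrap _ x) (wrap _ y) (i≡-i⇒i≡0 (begin
        t x y     ≡⟨ eq ⟩
        - t x′ y′ ≡⟨ cong -_ (get-cong T (≡-mod-sym (proj₁ cells≡)) (≡-mod-sym (proj₂ cells≡))) ⟩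
        - t x y   ∎))
        where
        cells≡ : x ≡ x′ mod + m × y ≡ y′ mod + m
        cells≡ = t-abs-injective (trans (cong ∣_∣ eq) (ℤP.∣-i∣≡∣i∣ (t x′ y′)))

      t-periodic : ∀ i c → t i (c + M) ≡ t i c
      t-periodic i c = get-cong T (≡-mod-refl {i}) (period-m c)

      table-relation : ∀ i c → verticalSum t i c ≡ horizontalSum t i c
      table-relation i c = begin
        verticalSum t i c
          ≡⟨ cong₂ _+_ (get-cong T (≡-mod-+ʳ (- + 1) i≡) c≡) (get-cong T (≡-mod-+ʳ (+ 1) i≡) c≡) ⟩
        verticalSum t (ι a) (ι b)
          ≡⟨ subst (λ h′ → verticalSum t (ι a) (ι b) ≡ OddPeriod.horizontalSum (+ h′) t (ι a) (ι b))
                   half-pred (proj₂ dm-table a b) ⟩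
        horizontalSum t (ι a) (ι b)
          ≡⟨ cong₂ _+_ (get-cong T (≡-mod-sym i≡) (≡-mod-+ʳ (+ h) (≡-mod-sym c≡)))
                       (get-cong T (≡-mod-sym i≡) (≡-mod-+ʳ (- + h) (≡-mod-sym c≡))) ⟩
        horizontalSum t i c ∎
        where
        a b : Fin m
        a = wrap _ i
        b = wrap _ c

        i≡ : i ≡ ι a mod + m
        i≡ = ≡-mod-sym (ι-wrap _ i)

        c≡ : c ≡ ι b mod + m
        c≡ = ≡-mod-sym (ι-wrap _ c)

      ex-even : ∀ a b → toℕ b ℕ.% 2 ≡ 0 → E a b ≡ t (ι a) (+ (toℕ b ℕ./ 2))
      ex-even a b r≡0 with toℕ b ℕ.% 2 | r≡0
      ... | zero | _ = refl

      ex-odd : ∀ a b → toℕ b ℕ.% 2 ≡ 1 → E a b ≡ - t (ι a) (+ ((toℕ b ℕ.+ m) ℕ./ 2))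
      ex-odd a b r≡1 with toℕ b ℕ.% 2 | r≡1
      ... | suc _ | _ = refl

      ex-at-even : ∀ a b q → toℕ b ≡ 2 ℕ.* q → E a b ≡ t (ι a) (+ q)
      ex-at-even a b q b≡ = begin
        E a b                       ≡⟨ ex-even a b (trans (cong (ℕ._% 2) b≡) 2q%2≡0) ⟩
        t (ι a) (+ (toℕ b ℕ./ 2))   ≡⟨ cong (λ r → t (ι a) (+ (r ℕ./ 2))) b≡ ⟩
        t (ι a) (+ (2 ℕ.* q ℕ./ 2)) ≡⟨ cong (λ r → t (ι a) (+ r)) 2q/2≡q ⟩
        t (ι a) (+ q)               ∎
        where
        2q%2≡0 : 2 ℕ.* q ℕ.% 2 ≡ 0
        2q%2≡0 = trans (cong (ℕ._% 2) (ℕP.*-comm 2 q)) (ℕD.m*n%n≡0 q 2)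

        2q/2≡q : 2 ℕ.* q ℕ./ 2 ≡ q
        2q/2≡q = trans (cong (ℕ._/ 2) (ℕP.*-comm 2 q)) (ℕD.m*n/n≡m q 2)

      ex-at-odd : ∀ a b q → toℕ b ≡ suc (2 ℕ.* q) → E a b ≡ - t (ι a) (+ q + K)
      ex-at-odd a b q b≡ = begin
        E a b                                   ≡⟨ ex-odd a b (trans (cong (ℕ._% 2) b≡) 2q+1%2≡1) ⟩
        - t (ι a) (+ ((toℕ b ℕ.+ m) ℕ./ 2))     ≡⟨ cong (λ r → - t (ι a) (+ ((r ℕ.+ m) ℕ./ 2))) b≡ ⟩
        - t (ι a) (+ ((suc (2 ℕ.* q) ℕ.+ m) ℕ./ 2)) ≡⟨ cong (λ r → - t (ι a) (+ r)) shifted-half ⟩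
        - t (ι a) (+ (q ℕ.+ suc h))             ≡⟨ cong (λ y → - t (ι a) y) (ℤP.pos-+ q (suc h)) ⟩
        - t (ι a) (+ q + K)                     ∎
        where
        2q+1%2≡1 : suc (2 ℕ.* q) ℕ.% 2 ≡ 1
        2q+1%2≡1 = trans (cong (λ r → suc r ℕ.% 2) (ℕP.*-comm 2 q)) (ℕD.[m+kn]%n≡m%n 1 q 2)

        double : suc (2 ℕ.* q) ℕ.+ suc (2 ℕ.* h) ≡ (q ℕ.+ suc h) ℕ.* 2
        double = ℕ-Solver.solve (q ∷ h ∷ [])

        shifted-half : (suc (2 ℕ.* q) ℕ.+ m) ℕ./ 2 ≡ q ℕ.+ suc h
        shifted-half = trans (cong (ℕ._/ 2) double) (ℕD.m*n/n≡m (q ℕ.+ suc h) 2)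

      even-column : ∀ a b c → ι b ≡ + 2 * c mod + (2 ℕ.* m) → E a b ≡ t (ι a) c
      even-column a b c b≡ with fin-even-or-odd {m} b
      ... | q , _ , inj₁ b≡2q = trans (ex-at-even a b q b≡2q) (get-cong T (≡-mod-refl {ι a}) q≡c)
        where
        2q≡ : + 2 * + q ≡ + 2 * c mod + 2 * + m
        2q≡ = mod-2m⇒ (subst (λ z → z ≡ + 2 * c mod + (2 ℕ.* m)) (ι-even b q b≡2q) b≡)

        q≡c : + q ≡ c mod + m
        q≡c = ≡-mod-halve 2q≡
      ... | q , _ , inj₂ b≡2q+1 = ⊥-elim (even≢odd-mod {c} {+ q} {+ m} (≡-mod-sym 2q+1≡))
        where
        2q+1≡ : + 2 * + q + + 1 ≡ + 2 * c mod + 2 * + m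
        2q+1≡ = mod-2m⇒ (subst (λ z → z ≡ + 2 * c mod + (2 ℕ.* m)) (ι-odd b q b≡2q+1) b≡)

      odd-column : ∀ a b c → ι b ≡ + 2 * c + + 1 mod + (2 ℕ.* m) → E a b ≡ - t (ι a) (c + K)
      odd-column a b c b≡ with fin-even-or-odd {m} b
      ... | q , _ , inj₁ b≡2q = ⊥-elim (even≢odd-mod {+ q} {c} {+ m} 2q≡)
        where
        2q≡ : + 2 * + q ≡ + 2 * c + + 1 mod + 2 * + m
        2q≡ = mod-2m⇒ (subst (λ z → z ≡ + 2 * c + + 1 mod + (2 ℕ.* m)) (ι-even b q b≡2q) b≡)
      ... | q , _ , inj₂ b≡2q+1 = trans (ex-at-odd a b q b≡2q+1) (cong -_ (get-cong T (≡-mod-refl {ι a}) q+K≡))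
        where
        2q+1≡ : + 2 * + q + + 1 ≡ + 2 * c + + 1 mod + 2 * + m
        2q+1≡ = mod-2m⇒ (subst (λ z → z ≡ + 2 * c + + 1 mod + (2 ℕ.* m)) (ι-odd b q b≡2q+1) b≡)

        q≡c : + q ≡ c mod + m
        q≡c = ≡-mod-halve (≡-mod-+ʳ-cancel (+ 1) 2q+1≡)

        q+K≡ : + q + K ≡ c + K mod + m
        q+K≡ = ≡-mod-+ʳ K q≡c

      even-columns : ∀ x c → G x (+ 2 * c) ≡ t x c
      even-columns x c = trans (even-column (wrap _ x) (wrap _ (+ 2 * c)) c (ι-wrap _ (+ 2 * c)))
                               (get-cong T (ι-wrap _ x) (≡-mod-refl {c}))

      odd-columns : ∀ x c → G x (+ 2 * c + + 1) ≡ - t x (c + K)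
      odd-columns x c = trans (odd-column (wrap _ x) (wrap _ (+ 2 * c + + 1)) c (ι-wrap _ (+ 2 * c + + 1)))
                              (cong -_ (get-cong T (ι-wrap _ x) (≡-mod-refl {c + K})))

    open Interleaving G t even-columns odd-columns t-periodic

    private
      labels-in-𝒩 : ∀ a b → In𝒩 (m ℕ.* (2 ℕ.* m)) (E a b)
      labels-in-𝒩 a b with fin-even-or-odd {m} b
      ... | q , _ , inj₁ b≡ =
        to-m·2m (subst (In𝒩 _) (sym (ex-at-even a b q b≡)) (entry-In𝒩 (wrap _ (ι a)) (wrap _ (+ q))))
      ... | q , _ , inj₂ b≡ =
        to-m·2m (subst (In𝒩 _) (sym (ex-at-odd a b q b≡)) (In𝒩-neg (entry-In𝒩 (wrap _ (ι a)) (wrap _ (+ q + K)))))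

      injective : ∀ a b a′ b′ → E a b ≡ E a′ b′ → a ≡ a′ × b ≡ b′
      injective a b a′ b′ eq with fin-even-or-odd {m} b | fin-even-or-odd {m} b′
      ... | q , q<m , inj₁ b≡ | q′ , q′<m , inj₁ b′≡ =
        ι-≡-mod⇒≡ (proj₁ cells≡) , FinP.toℕ-injective (begin
          toℕ b    ≡⟨ b≡ ⟩
          2 ℕ.* q  ≡⟨ cong (2 ℕ.*_) (≡-mod⇒≡ q<m q′<m (proj₂ cells≡)) ⟩
          2 ℕ.* q′ ≡⟨ b′≡ ⟨
          toℕ b′   ∎)
        where
        cells≡ : ι a ≡ ι a′ mod + m × + q ≡ + q′ mod + m
        cells≡ = t-abs-injective (cong ∣_∣ (trans (sym (ex-at-even a b q b≡)) (trans eq (ex-at-even a′ b′ q′ b′≡))))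
      ... | q , q<m , inj₂ b≡ | q′ , q′<m , inj₂ b′≡ =
        ι-≡-mod⇒≡ (proj₁ cells≡) , FinP.toℕ-injective (begin
          toℕ b          ≡⟨ b≡ ⟩
          suc (2 ℕ.* q)  ≡⟨ cong (λ r → suc (2 ℕ.* r)) (≡-mod⇒≡ q<m q′<m (≡-mod-+ʳ-cancel K (proj₂ cells≡))) ⟩
          suc (2 ℕ.* q′) ≡⟨ b′≡ ⟨
          toℕ b′         ∎)
        where
        cells≡ : ι a ≡ ι a′ mod + m × + q + K ≡ + q′ + K mod + m
        cells≡ = t-abs-injective (cong ∣_∣ (ℤP.neg-injective
                   (trans (sym (ex-at-odd a b q b≡)) (trans eq (ex-at-odd a′ b′ q′ b′≡)))))
      ... | q , _ , inj₁ b≡ | q′ , _ , inj₂ b′≡ = ⊥-elim (t-no-opposites (ι a) (+ q) (ι a′) (+ q′ + K)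
              (trans (sym (ex-at-even a b q b≡)) (trans eq (ex-at-odd a′ b′ q′ b′≡))))
      ... | q , _ , inj₂ b≡ | q′ , _ , inj₁ b′≡ = ⊥-elim (t-no-opposites (ι a′) (+ q′) (ι a) (+ q + K)
              (trans (sym (ex-at-even a′ b′ q′ b′≡)) (trans (sym eq) (ex-at-odd a b q b≡))))

      surjective : ∀ k → In𝒩 (m ℕ.* (2 ℕ.* m)) k → Appears E k
      surjective k k∈ with covers k (from-m·2m k∈)
      ... | inj₁ (a , β , Taβ≡k) = appears-value E (ι a) (+ 2 * ι β) (begin
            G (ι a) (+ 2 * ι β) ≡⟨ even-columns (ι a) (ι β) ⟩
            t (ι a) (ι β)       ≡⟨ get-ι T a β ⟩
            T a β               ≡⟨ Taβ≡k ⟩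
            k                   ∎)
      ... | inj₂ (a , β , Taβ≡-k) = appears-value E (ι a) (+ 2 * ι β + M) (begin
            G (ι a) (+ 2 * ι β + M) ≡⟨ even-antiperiodic (ι a) (ι β) ⟩
            - t (ι a) (ι β)         ≡⟨ cong -_ (get-ι T a β) ⟩
            - T a β                 ≡⟨ cong -_ Taβ≡-k ⟩
            - - k                   ≡⟨ ℤP.neg-involutive k ⟩
            k                       ∎)

      zero-sums : ∀ (a : Fin m) (b : Fin (2 ℕ.* m)) → neighbourSum G (ι a) (ι b) ≡ + 0
      zero-sums a b with fin-even-or-odd {m} b
      ... | q , _ , inj₁ b≡ = begin
        neighbourSum G (ι a) (ι b)
          ≡⟨ cong (neighbourSum G (ι a)) (ι-even b q b≡) ⟩
        neighbourSum G (ι a) (+ 2 * + q)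
          ≡⟨ neighbourSum-even (ι a) (+ q) ⟩
        verticalSum t (ι a) (+ q) - horizontalSum t (ι a) (+ q)
          ≡⟨ ℤP.i≡j⇒i-j≡0 (table-relation (ι a) (+ q)) ⟩
        + 0 ∎
      ... | q , _ , inj₂ b≡ = begin
        neighbourSum G (ι a) (ι b)
          ≡⟨ cong (neighbourSum G (ι a)) (ι-odd b q b≡) ⟩
        neighbourSum G (ι a) (+ 2 * + q + + 1)
          ≡⟨ neighbourSum-odd (ι a) (+ q) ⟩
        - (verticalSum t (ι a) (+ q + K) - horizontalSum t (ι a) (+ q + K))
          ≡⟨ cong -_ (ℤP.i≡j⇒i-j≡0 (table-relation (ι a) (+ q + K))) ⟩
        + 0 ∎

    extended-table-is-DM : IsDMLabeling E
    extended-table-is-DM = labels-in-𝒩 , injective , surjective , zero-sums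

open import Data.Nat using (_≤_; _*_)

lemma3p1 : (m : ℕ) → 3 ≤ m → Odd m →
    ((L : Tbl m (2 * m)) → IsDMLabeling L → IsDMTable (re L))
    × ((T : Tbl m m) → IsDMTable T → IsDMLabeling (ex T) × IsDistanceMagic m (2 * m))
lemma3p1 m _ (h , refl) rewrite ℕP.+-comm (2 * h) 1 =
  Torus.Reduction.reduced-table-is-DM h ,
  λ T dm-table → let labelling = Torus.Extension.extended-table-is-DM h T dm-table
                 in labelling , (ex T , labelling)
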